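{- For every tree $T$ with $|T|\ge2$ vertices, $\gamma(T)\ge\frac14\big(|\mathit{Deg}_{\ge2}(T)|+|\mathit{Supp}(T)|\big)$.
   Context: $\gamma(T)$ is the size of a minimum dominating set of $T$. $\mathit{Deg}_{\ge2}(T)$ is the set of vertices of degree at least $2$; $\mathit{Supp}(T)$ is the set of support vertices, i.e., vertices adjacent to at least one leaf (vertex of degree $1$). -}

module Defs where

open import Data.Nat using (ℕ; suc; _≥_; _*_; _+_; _∸_)
open import Data.Bool using (Bool; true; false; T)
open import Data.Fin using (Fin; _<_; _<?_)
open import Data.Fin.Subset using (Subset; _∈_; ∣_∣)
open import Data.List using (List; length; filter; allFin; concatMap; map; [])
open import Data.List.Relation.Unary.Any using (any?)
open import Data.Product using (Σ; _×_; _,_; ∃)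
open import Data.Sum using (_⊎_)
open import Relation.Binary.PropositionalEquality using (_≡_)
open import Relation.Nullary using (¬_)
open import Relation.Nullary.Decidable using (_×-dec_)
open import Data.Bool.Properties using (T?)

record Graph (n : ℕ) : Set where
  field
    adj       : Fin n → Fin n → Bool
    symmetric : ∀ i j → adj i j ≡ adj j i
    irreflexive : ∀ i → adj i i ≡ false
open Graph public

module _ {n : ℕ} (G : Graph n) where

  data Reach : Fin n → Fin n → Set where
    here  : ∀ {u} → Reach u u
    step  : ∀ {u v w} → T (adj G u v) → Reach v w → Reach u w

  Connected : Set
  Connected = ∀ u v → Reach u v

  edgeCount : ℕ
  edgeCount = length (filter (λ p → T? (adj G (Data.Product.proj₁ p) (Data.Product.proj₂ p)))
                        (filter (λ p → Data.Product.proj₁ p <? Data.Product.proj₂ p)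
                          (concatMap (λ i → map (λ j → (i , j)) (allFin n)) (allFin n))))

  -- a tree: connected graph with n - 1 edges (n ≥ 1 is enforced separately)
  IsTree : Set
  IsTree = Connected × (edgeCount ≡ n ∸ 1)

  neighbours : Fin n → List (Fin n)
  neighbours v = filter (λ u → T? (adj G v u)) (allFin n)

  degree : Fin n → ℕ
  degree v = length (neighbours v)

  IsLeaf : Fin n → Set
  IsLeaf v = degree v ≡ 1

  deg≥2 : List (Fin n)
  deg≥2 = filter (λ v → Data.Nat._≤?_ 2 (degree v)) (allFin n)

  supp : List (Fin n)
  supp = filter (λ v → any? (λ u → T? (adj G v u) ×-dec (Data.Nat._≟_ (degree u) 1)) (allFin n))
                (allFin n)

  Dominating : Subset n → Set
  Dominating D = ∀ v → v ∈ D ⊎ ∃ λ u → u ∈ D × T (adj G u v)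

  IsDominationNumber : ℕ → Set
  IsDominationNumber k =
    (∃ λ D → Dominating D × ∣ D ∣ ≡ k) × (∀ D → Dominating D → k Data.Nat.≤ ∣ D ∣)

-- Let D be any dominating set.
-- If some support vertex is itself a leaf, connectedness forces T = K₂, and the bound is trivial.
-- Otherwise Supp(T) injects into D: a support vertex outside D goes to a leaf neighbour, which
-- must be in D.  For Deg≥2(T), count degrees: every vertex outside D has a neighbour in D, so
-- |V∖D| ≤ Σ_{v∈D} deg v, and a vertex outside D has degree ≥ 1 + [deg ≥ 2], so
-- |V∖D| + |Deg≥2 ∖ D| ≤ Σ_{v∉D} deg v.  Adding, and using Σ deg = 2|E| ≤ 2n = 2|D| + 2|V∖D|,
-- gives |Deg≥2 ∖ D| ≤ 2|D|, hence |Deg≥2| ≤ 3|D|.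

module Submission where

open import Defs
open import Data.Nat
  using (ℕ; zero; suc; _+_; _*_; _≤_; _≥_; z≤n; s≤s; _≤?_; _≟_)
open import Data.Nat.Properties
  using ( +-*-semiring; +-commutativeSemigroup; +-comm; +-assoc; +-identityʳ
        ; *-identityʳ; *-identityˡ; *-distribʳ-+
        ; *-suc; *-assoc; *-distribˡ-+; ≤-refl; ≤-trans; ≤-reflexive; m≤m+n; m≤n+m
        ; ≤⇒≯; +-mono-≤; +-monoʳ-≤; +-cancelˡ-≤; *-monoʳ-≤; *-monoˡ-≤; m∸n≤m; module ≤-Reasoning )
open import Algebra.Properties.Semiring.Sum +-*-semiring
  using (sum; sum-syntax; sum-cong-≗; ∑-distrib-+; ∑-comm; *-distribˡ-sum)
open import Algebra.Properties.CommutativeSemigroup +-commutativeSemigroup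
  using (interchange)
open import Data.Bool using (Bool; true; false; not; T; _∧_)
open import Data.Bool.Properties using (T?; ∧-zeroʳ; not-involutive)
open import Data.Fin using (Fin; zero; suc; _<_; _<?_)
open import Data.Fin.Properties using (any?; <-cmp)
open import Data.Fin.Subset using (Subset; ∣_∣)
open import Data.Vec using ([]; _∷_; lookup)
open import Data.Vec.Properties using ([]=⇒lookup)
open import Data.List using (List; []; _∷_; _++_; length; filter; tabulate; allFin; concat; concatMap; map)
open import Data.List.Properties
  using (filter-++; length-++; length-filter; length-tabulate; map-tabulate; filter-none)
open import Data.List.Membership.Propositional using (_∈_)
open import Data.List.Membership.Propositional.Properties using (∈-filter⁺; ∈-allFin)
open import Data.List.Relation.Unary.All as All using ()
open import Data.List.Relation.Unary.Any using (Any; here; satisfied)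
import Data.List.Relation.Unary.Any as Any
open import Data.Product using (∃; _×_; _,_; proj₁; proj₂)
open import Data.Sum using (_⊎_; inj₁; inj₂)
open import Data.Empty using (⊥-elim)
open import Function using (_∘_; id)
open import Relation.Binary.PropositionalEquality
  using (_≡_; refl; sym; trans; cong; cong₂; subst; module ≡-Reasoning)
open import Relation.Binary using (tri<; tri≈; tri>)
open import Relation.Nullary using (Dec; does; yes; no; ¬_)
open import Relation.Nullary.Decidable using (dec-true; dec-false; _×-dec_)
open import Relation.Unary using (Pred; Decidable)
open import Relation.Unary.Properties using (_∩?_)

𝟙 : Bool → ℕ
𝟙 true  = 1
𝟙 false = 0

𝟙-+-𝟙-not : ∀ b → 𝟙 b + 𝟙 (not b) ≡ 1
𝟙-+-𝟙-not true  = refl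
𝟙-+-𝟙-not false = refl

T⇒𝟙≡1 : ∀ {b} → T b → 𝟙 b ≡ 1
T⇒𝟙≡1 {true} _ = refl

𝟙-*-mono-≤ : ∀ b {x y} → (b ≡ true → x ≤ y) → 𝟙 b * x ≤ 𝟙 b * y
𝟙-*-mono-≤ true  x≤y = *-monoʳ-≤ 1 (x≤y refl)
𝟙-*-mono-≤ false _   = z≤n

≤-𝟙-+-𝟙-not-* : ∀ b {x} → x ≤ 1 → x ≤ 𝟙 b + 𝟙 (not b) * x
≤-𝟙-+-𝟙-not-* true  x≤1 = x≤1
≤-𝟙-+-𝟙-not-* false {x} _ = ≤-reflexive (sym (+-identityʳ x))

𝟙-does-≤1 : ∀ {p} {P : Set p} (p? : Dec P) → 𝟙 (does p?) ≤ 1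
𝟙-does-≤1 (yes _) = ≤-refl
𝟙-does-≤1 (no _)  = z≤n

𝟙-does-exclusive : ∀ {p q} {P : Set p} {Q : Set q} (p? : Dec P) (q? : Dec Q) →
                   ¬ (P × Q) → 𝟙 (does p?) + 𝟙 (does q?) ≤ 1
𝟙-does-exclusive (yes p) (yes q) ¬p×q = ⊥-elim (¬p×q (p , q))
𝟙-does-exclusive (yes _) (no _)  _    = ≤-refl
𝟙-does-exclusive (no _)  (yes _) _    = ≤-refl
𝟙-does-exclusive (no _)  (no _)  _    = z≤n

𝟙-≟1-*-self : ∀ x → 𝟙 (does (x ≟ 1)) * x ≡ 𝟙 (does (x ≟ 1))
𝟙-≟1-*-self 0             = refl
𝟙-≟1-*-self 1             = refl
𝟙-≟1-*-self (suc (suc x)) = refl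

suc-𝟙-2≤?-≤ : ∀ {x} → 1 ≤ x → suc (𝟙 (does (2 ≤? x))) ≤ x
suc-𝟙-2≤?-≤ {1}           _ = ≤-refl
suc-𝟙-2≤?-≤ {suc (suc x)} _ = s≤s (s≤s z≤n)

sum-mono-≤ : ∀ {n} {f g : Fin n → ℕ} → (∀ i → f i ≤ g i) → sum f ≤ sum g
sum-mono-≤ {zero}  _   = z≤n
sum-mono-≤ {suc n} f≤g = +-mono-≤ (f≤g zero) (sum-mono-≤ (f≤g ∘ suc))

term≤sum : ∀ {n} (f : Fin n → ℕ) i → f i ≤ sum f
term≤sum f zero    = m≤m+n _ _
term≤sum f (suc i) = ≤-trans (term≤sum (f ∘ suc) i) (m≤n+m _ _)

sum-ones : ∀ n → ∑[ i < n ] 1 ≡ n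
sum-ones zero    = refl
sum-ones (suc n) = cong suc (sum-ones n)

∈-length≡1⇒≡ : ∀ {a} {A : Set a} {xs : List A} {x y} → length xs ≡ 1 → x ∈ xs → y ∈ xs → x ≡ y
∈-length≡1⇒≡ {xs = _ ∷ []} _ (here refl) (here refl) = refl

∈⇒length≥1 : ∀ {a} {A : Set a} {xs : List A} {x} → x ∈ xs → 1 ≤ length xs
∈⇒length≥1 {xs = _ ∷ _} _ = s≤s z≤n

module _ {a p} {A : Set a} {P : Pred A p} (P? : Decidable P) where

  length-filter-tabulate : ∀ {n} (f : Fin n → A) →
                           length (filter P? (tabulate f)) ≡ ∑[ i < n ] 𝟙 (does (P? (f i)))
  length-filter-tabulate {zero}  f = refl
  length-filter-tabulate {suc n} f with does (P? (f zero))
  ... | true  = cong suc (length-filter-tabulate (f ∘ suc))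
  ... | false = length-filter-tabulate (f ∘ suc)

  length-filter-concat-tabulate : ∀ {n} (g : Fin n → List A) →
    length (filter P? (concat (tabulate g))) ≡ ∑[ i < n ] length (filter P? (g i))
  length-filter-concat-tabulate {zero}  g = refl
  length-filter-concat-tabulate {suc n} g = begin
    length (filter P? (g zero ++ concat (tabulate (g ∘ suc))))
      ≡⟨ cong length (filter-++ P? (g zero) _) ⟩
    length (filter P? (g zero) ++ filter P? (concat (tabulate (g ∘ suc))))
      ≡⟨ length-++ (filter P? (g zero)) ⟩
    length (filter P? (g zero)) + length (filter P? (concat (tabulate (g ∘ suc))))
      ≡⟨ cong (length (filter P? (g zero)) +_) (length-filter-concat-tabulate (g ∘ suc)) ⟩
    ∑[ i < suc n ] length (filter P? (g i)) ∎
    where open ≡-Reasoning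

  filter-filter : ∀ {q} {Q : Pred A q} (Q? : Decidable Q) xs →
                  filter P? (filter Q? xs) ≡ filter (Q? ∩? P?) xs
  filter-filter Q? []       = refl
  filter-filter Q? (x ∷ xs) with does (Q? x)
  ... | false = filter-filter Q? xs
  ... | true with does (P? x)
  ...   | true  = cong (x ∷_) (filter-filter Q? xs)
  ...   | false = filter-filter Q? xs

length-filter-allPairs : ∀ {m n p} {P : Pred (Fin m × Fin n) p} (P? : Decidable P) →
  length (filter P? (concatMap (λ i → map (λ j → (i , j)) (allFin n)) (allFin m)))
    ≡ ∑[ i < m ] ∑[ j < n ] 𝟙 (does (P? (i , j)))
length-filter-allPairs {m} {n} P? = begin
  length (filter P? (concat (map row (allFin m))))
    ≡⟨ cong (length ∘ filter P? ∘ concat) (map-tabulate id row) ⟩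
  length (filter P? (concat (tabulate row)))
    ≡⟨ length-filter-concat-tabulate P? row ⟩
  ∑[ i < m ] length (filter P? (row i))
    ≡⟨ sum-cong-≗ (λ i → trans (cong (length ∘ filter P?) (map-tabulate id (i ,_)))
                               (length-filter-tabulate P? (i ,_))) ⟩
  ∑[ i < m ] ∑[ j < n ] 𝟙 (does (P? (i , j))) ∎
  where
  open ≡-Reasoning
  row : Fin m → List (Fin m × Fin n)
  row i = map (λ j → (i , j)) (allFin n)

module _ {n : ℕ} (G : Graph n) where

  adj-sym : ∀ {u v} → T (adj G u v) → T (adj G v u)
  adj-sym {u} {v} = subst T (symmetric G u v)

  adj⇒∈-neighbours : ∀ {u v} → T (adj G v u) → u ∈ neighbours G v
  adj⇒∈-neighbours {u} {v} = ∈-filter⁺ (λ w → T? (adj G v w)) (∈-allFin u)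

  adj⇒degree≥1 : ∀ {u v} → T (adj G v u) → 1 ≤ degree G v
  adj⇒degree≥1 = ∈⇒length≥1 ∘ adj⇒∈-neighbours

  leaf-neighbour-unique : ∀ {v a b} → IsLeaf G v → T (adj G v a) → T (adj G v b) → a ≡ b
  leaf-neighbour-unique leaf va vb =
    ∈-length≡1⇒≡ leaf (adj⇒∈-neighbours va) (adj⇒∈-neighbours vb)

  degree-≡-∑ : ∀ v → degree G v ≡ ∑[ u < n ] 𝟙 (adj G v u)
  degree-≡-∑ v = length-filter-tabulate (λ u → T? (adj G v u)) id

  edgeCount-≡-∑ : edgeCount G ≡ ∑[ i < n ] ∑[ j < n ] 𝟙 (does (i <? j) ∧ adj G i j)
  edgeCount-≡-∑ =
    trans (cong length (filter-filter adjacent? ordered? pairs)) (length-filter-allPairs (ordered? ∩? adjacent?))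
    where
    adjacent? : Decidable (λ (p : Fin n × Fin n) → T (adj G (proj₁ p) (proj₂ p)))
    adjacent? (i , j) = T? (adj G i j)
    ordered? : Decidable (λ (p : Fin n × Fin n) → proj₁ p < proj₂ p)
    ordered? (i , j) = i <? j
    pairs : List (Fin n × Fin n)
    pairs = concatMap (λ i → map (λ j → (i , j)) (allFin n)) (allFin n)

  𝟙-adj-split : ∀ i j → 𝟙 (adj G i j) ≡ 𝟙 (does (i <? j) ∧ adj G i j) + 𝟙 (does (j <? i) ∧ adj G j i)
  𝟙-adj-split i j with <-cmp i j
  ... | tri< i<j _ j≮i rewrite dec-true (i <? j) i<j | dec-false (j <? i) j≮i =
    sym (+-identityʳ _)
  ... | tri> i≮j _ j<i rewrite dec-false (i <? j) i≮j | dec-true (j <? i) j<i =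
    cong 𝟙 (symmetric G i j)
  ... | tri≈ _ refl _ rewrite irreflexive G i | ∧-zeroʳ (does (i <? i)) = refl

  handshake : ∑[ v < n ] degree G v ≡ edgeCount G + edgeCount G
  handshake = begin
    ∑[ v < n ] degree G v
      ≡⟨ sum-cong-≗ degree-≡-∑ ⟩
    ∑[ i < n ] ∑[ j < n ] 𝟙 (adj G i j)
      ≡⟨ sum-cong-≗ (λ i → trans (sum-cong-≗ (𝟙-adj-split i)) (∑-distrib-+ (forward i) (backward i))) ⟩
    ∑[ i < n ] (∑[ j < n ] forward i j + ∑[ j < n ] backward i j)
      ≡⟨ ∑-distrib-+ (λ i → ∑[ j < n ] forward i j) (λ i → ∑[ j < n ] backward i j) ⟩
    ∑[ i < n ] ∑[ j < n ] forward i j + ∑[ i < n ] ∑[ j < n ] backward i j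
      ≡⟨ cong (∑[ i < n ] ∑[ j < n ] forward i j +_) (∑-comm backward) ⟩
    ∑[ i < n ] ∑[ j < n ] forward i j + ∑[ j < n ] ∑[ i < n ] forward j i
      ≡⟨ cong₂ _+_ (sym edgeCount-≡-∑) (sym edgeCount-≡-∑) ⟩
    edgeCount G + edgeCount G ∎
    where
    open ≡-Reasoning
    forward backward : Fin n → Fin n → ℕ
    forward  i j = 𝟙 (does (i <? j) ∧ adj G i j)
    backward i j = forward j i

  ∑-*-degree : ∀ (f : Fin n → ℕ) →
               ∑[ v < n ] (f v * degree G v) ≡ ∑[ u < n ] ∑[ v < n ] (f v * 𝟙 (adj G v u))
  ∑-*-degree f = begin
    ∑[ v < n ] (f v * degree G v)                   ≡⟨ sum-cong-≗ (λ v → cong (f v *_) (degree-≡-∑ v)) ⟩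
    ∑[ v < n ] (f v * ∑[ u < n ] 𝟙 (adj G v u))     ≡⟨ sum-cong-≗ (λ v → *-distribˡ-sum (f v) (λ u → 𝟙 (adj G v u))) ⟩
    ∑[ v < n ] ∑[ u < n ] (f v * 𝟙 (adj G v u))     ≡⟨ ∑-comm (λ v u → f v * 𝟙 (adj G v u)) ⟩
    ∑[ u < n ] ∑[ v < n ] (f v * 𝟙 (adj G v u))     ∎
    where open ≡-Reasoning

  leaf-edge⇒all-leaves : Connected G → ∀ {s u} → IsLeaf G s → IsLeaf G u → T (adj G s u) →
                         ∀ w → IsLeaf G w
  leaf-edge⇒all-leaves connected {s} {u} s-leaf u-leaf su w with closed (connected s w) (inj₁ refl)
    where
    closed : ∀ {x y} → Reach G x y → x ≡ s ⊎ x ≡ u → y ≡ s ⊎ y ≡ u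
    closed here           x∈su        = x∈su
    closed (step xz z⇝y) (inj₁ refl) = closed z⇝y (inj₂ (leaf-neighbour-unique s-leaf xz su))
    closed (step xz z⇝y) (inj₂ refl) = closed z⇝y (inj₁ (leaf-neighbour-unique u-leaf xz (adj-sym su)))
  ... | inj₁ refl = s-leaf
  ... | inj₂ refl = u-leaf

  IsSupport : Fin n → Set
  IsSupport v = Any (λ u → T (adj G v u) × IsLeaf G u) (allFin n)

  isSupport? : Decidable IsSupport
  isSupport? v = Any.any? (λ u → T? (adj G v u) ×-dec (degree G u ≟ 1)) (allFin n)

  length-deg≥2-≡-∑ : length (deg≥2 G) ≡ ∑[ v < n ] 𝟙 (does (2 ≤? degree G v))
  length-deg≥2-≡-∑ = length-filter-tabulate (λ v → 2 ≤? degree G v) id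

  length-supp-≡-∑ : length (supp G) ≡ ∑[ v < n ] 𝟙 (does (isSupport? v))
  length-supp-≡-∑ = length-filter-tabulate isSupport? id

  length-supp≤n : length (supp G) ≤ n
  length-supp≤n = ≤-trans (length-filter isSupport? (allFin n)) (≤-reflexive (length-tabulate id))

  length-deg≥2≡0 : (∀ v → degree G v ≤ 1) → length (deg≥2 G) ≡ 0
  length-deg≥2≡0 degree≤1 =
    cong length (filter-none (λ v → 2 ≤? degree G v) {allFin n} (All.tabulate λ {v} _ → ≤⇒≯ (degree≤1 v)))

member nonmember : ∀ {n} → Subset n → Fin n → ℕ
member    D v = 𝟙 (lookup D v)
nonmember D v = 𝟙 (not (lookup D v))

∣p∣≡∑member : ∀ {n} (p : Subset n) → ∣ p ∣ ≡ sum (member p)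
∣p∣≡∑member []          = refl
∣p∣≡∑member (true  ∷ p) = cong suc (∣p∣≡∑member p)
∣p∣≡∑member (false ∷ p) = ∣p∣≡∑member p

∑member+∑nonmember : ∀ {n} (D : Subset n) → sum (member D) + sum (nonmember D) ≡ n
∑member+∑nonmember {n} D = begin
  sum (member D) + sum (nonmember D)        ≡⟨ ∑-distrib-+ (member D) (nonmember D) ⟨
  ∑[ v < n ] (member D v + nonmember D v)   ≡⟨ sum-cong-≗ (𝟙-+-𝟙-not ∘ lookup D) ⟩
  ∑[ v < n ] 1                              ≡⟨ sum-ones n ⟩
  n                                         ∎
  where open ≡-Reasoning

∑-split-member : ∀ {n} (D : Subset n) (f : Fin n → ℕ) →
                 sum f ≡ ∑[ v < n ] (member D v * f v) + ∑[ v < n ] (nonmember D v * f v)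
∑-split-member {n} D f = trans (sum-cong-≗ split) (∑-distrib-+ (λ v → member D v * f v) (λ v → nonmember D v * f v))
  where
  split : ∀ v → f v ≡ member D v * f v + nonmember D v * f v
  split v = begin
    f v                                 ≡⟨ *-identityˡ (f v) ⟨
    1 * f v                             ≡⟨ cong (_* f v) (𝟙-+-𝟙-not (lookup D v)) ⟨
    (member D v + nonmember D v) * f v  ≡⟨ *-distribʳ-+ (f v) (member D v) (nonmember D v) ⟩
    member D v * f v + nonmember D v * f v ∎
    where open ≡-Reasoning

module _ {n : ℕ} (G : Graph n) (D : Subset n) (dominating : Dominating G D) where

  dominator : ∀ {v} → lookup D v ≡ false → ∃ λ u → lookup D u ≡ true × T (adj G u v)
  dominator {v} v∉D with dominating v
  ... | inj₁ v∈D with () ← trans (sym v∉D) ([]=⇒lookup v∈D)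
  ... | inj₂ (u , u∈D , uv) = u , []=⇒lookup u∈D , uv

  ∑nonmember≤∑member*degree : sum (nonmember D) ≤ ∑[ v < n ] (member D v * degree G v)
  ∑nonmember≤∑member*degree =
    ≤-trans (sum-mono-≤ dominated) (≤-reflexive (sym (∑-*-degree G (member D))))
    where
    dominated : ∀ u → nonmember D u ≤ ∑[ v < n ] (member D v * 𝟙 (adj G v u))
    dominated u with lookup D u in u∈?D
    ... | true  = z≤n
    ... | false with dominator u∈?D
    ...   | w , w∈D , wu = ≤-trans (≤-reflexive (sym (cong₂ _*_ (cong 𝟙 w∈D) (T⇒𝟙≡1 wu))))
                                   (term≤sum (λ v → member D v * 𝟙 (adj G v u)) w)

  n≤2∣D∣ : (∀ v → degree G v ≤ 1) → n ≤ 2 * ∣ D ∣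
  n≤2∣D∣ degree≤1 = begin
    n                                             ≡⟨ ∑member+∑nonmember D ⟨
    sum (member D) + sum (nonmember D)            ≤⟨ +-monoʳ-≤ (sum (member D)) ∑nonmember≤∑member*degree ⟩
    sum (member D) + ∑[ v < n ] (member D v * degree G v)
      ≤⟨ +-monoʳ-≤ (sum (member D)) (sum-mono-≤ (λ v → *-monoʳ-≤ (member D v) (degree≤1 v))) ⟩
    sum (member D) + ∑[ v < n ] (member D v * 1)  ≡⟨ cong (sum (member D) +_) (sum-cong-≗ (*-identityʳ ∘ member D)) ⟩
    sum (member D) + sum (member D)               ≡⟨ cong (λ x → x + x) (∣p∣≡∑member D) ⟨
    ∣ D ∣ + ∣ D ∣                                 ≡⟨ cong (∣ D ∣ +_) (+-identityʳ ∣ D ∣) ⟨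
    2 * ∣ D ∣                                     ∎
    where open ≤-Reasoning

  ∣deg≥2∣≤3∣D∣ : edgeCount G ≤ n → length (deg≥2 G) ≤ 3 * ∣ D ∣
  ∣deg≥2∣≤3∣D∣ edges≤n = begin
    length (deg≥2 G)                                ≡⟨ length-deg≥2-≡-∑ G ⟩
    sum high                                        ≤⟨ sum-mono-≤ high≤member+nonmember*high ⟩
    ∑[ v < n ] (member D v + nonmember D v * high v) ≡⟨ ∑-distrib-+ (member D) (λ v → nonmember D v * high v) ⟩
    a + c                                           ≤⟨ +-monoʳ-≤ a c≤a+a ⟩
    a + (a + a)                                     ≡⟨ cong (λ x → a + (a + x)) (+-identityʳ a) ⟨
    3 * a                                           ≡⟨ cong (3 *_) (∣p∣≡∑member D) ⟨
    3 * ∣ D ∣                                       ∎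
    where
    open ≤-Reasoning
    high : Fin n → ℕ
    high v = 𝟙 (does (2 ≤? degree G v))
    a b c : ℕ
    a = sum (member D)
    b = sum (nonmember D)
    c = ∑[ v < n ] (nonmember D v * high v)

    high≤member+nonmember*high : ∀ v → high v ≤ member D v + nonmember D v * high v
    high≤member+nonmember*high v = ≤-𝟙-+-𝟙-not-* (lookup D v) (𝟙-does-≤1 (2 ≤? degree G v))

    nonmember-degree : ∀ v → nonmember D v * suc (high v) ≤ nonmember D v * degree G v
    nonmember-degree v = 𝟙-*-mono-≤ (not (lookup D v)) λ v∉D →
      let (_ , _ , uv) = dominator (trans (sym (not-involutive _)) (cong not v∉D))
      in suc-𝟙-2≤?-≤ (adj⇒degree≥1 G (adj-sym G uv))

    b+c≤∑nonmember*degree : b + c ≤ ∑[ v < n ] (nonmember D v * degree G v)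
    b+c≤∑nonmember*degree = begin
      b + c                                          ≡⟨ ∑-distrib-+ (nonmember D) (λ v → nonmember D v * high v) ⟨
      ∑[ v < n ] (nonmember D v + nonmember D v * high v) ≡⟨ sum-cong-≗ (λ v → *-suc (nonmember D v) (high v)) ⟨
      ∑[ v < n ] (nonmember D v * suc (high v))      ≤⟨ sum-mono-≤ nonmember-degree ⟩
      ∑[ v < n ] (nonmember D v * degree G v)        ∎

    c≤a+a : c ≤ a + a
    c≤a+a = +-cancelˡ-≤ (b + b) c (a + a) (begin
      (b + b) + c                                    ≡⟨ +-assoc b b c ⟩
      b + (b + c)                                    ≤⟨ +-mono-≤ ∑nonmember≤∑member*degree b+c≤∑nonmember*degree ⟩
      ∑[ v < n ] (member D v * degree G v) + ∑[ v < n ] (nonmember D v * degree G v)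
                                                     ≡⟨ ∑-split-member D (degree G) ⟨
      ∑[ v < n ] degree G v                          ≡⟨ handshake G ⟩
      edgeCount G + edgeCount G                      ≤⟨ +-mono-≤ edges≤n edges≤n ⟩
      n + n                                          ≡⟨ cong (λ x → x + x) (∑member+∑nonmember D) ⟨
      (a + b) + (a + b)                              ≡⟨ interchange a b a b ⟩
      (a + a) + (b + b)                              ≡⟨ +-comm (a + a) (b + b) ⟩
      (b + b) + (a + a)                              ∎)

  ∣supp∣≤∣D∣ : (∀ v → IsSupport G v → ¬ IsLeaf G v) → length (supp G) ≤ ∣ D ∣
  ∣supp∣≤∣D∣ support⇒¬leaf = begin
    length (supp G)                                       ≡⟨ length-supp-≡-∑ G ⟩
    sum support                                           ≤⟨ sum-mono-≤ support-charged ⟩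
    ∑[ s < n ] (member D s * support s + ∑[ u < n ] (leafMember u * 𝟙 (adj G u s)))
      ≡⟨ ∑-distrib-+ (λ s → member D s * support s) (λ s → ∑[ u < n ] (leafMember u * 𝟙 (adj G u s))) ⟩
    ∑[ s < n ] (member D s * support s) + ∑[ s < n ] ∑[ u < n ] (leafMember u * 𝟙 (adj G u s))
      ≡⟨ cong (∑[ s < n ] (member D s * support s) +_) (∑-*-degree G leafMember) ⟨
    ∑[ s < n ] (member D s * support s) + ∑[ u < n ] (leafMember u * degree G u)
      ≡⟨ cong (∑[ s < n ] (member D s * support s) +_) (sum-cong-≗ leafMember-*-degree) ⟩
    ∑[ s < n ] (member D s * support s) + sum leafMember
      ≡⟨ ∑-distrib-+ (λ s → member D s * support s) leafMember ⟨
    ∑[ s < n ] (member D s * support s + leafMember s)    ≤⟨ sum-mono-≤ support-or-leaf ⟩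
    sum (member D)                                        ≡⟨ ∣p∣≡∑member D ⟨
    ∣ D ∣                                                 ∎
    where
    open ≤-Reasoning
    support leaf leafMember : Fin n → ℕ
    support    v = 𝟙 (does (isSupport? G v))
    leaf       v = 𝟙 (does (degree G v ≟ 1))
    leafMember v = member D v * leaf v

    leafMember-*-degree : ∀ u → leafMember u * degree G u ≡ leafMember u
    leafMember-*-degree u = trans (*-assoc (member D u) (leaf u) (degree G u))
                                  (cong (member D u *_) (𝟙-≟1-*-self (degree G u)))

    support-or-leaf : ∀ s → member D s * support s + leafMember s ≤ member D s
    support-or-leaf s = begin
      member D s * support s + member D s * leaf s ≡⟨ *-distribˡ-+ (member D s) (support s) (leaf s) ⟨
      member D s * (support s + leaf s)            ≤⟨ *-monoʳ-≤ (member D s) exclusive ⟩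
      member D s * 1                               ≡⟨ *-identityʳ (member D s) ⟩
      member D s                                   ∎
      where
      exclusive : support s + leaf s ≤ 1
      exclusive = 𝟙-does-exclusive (isSupport? G s) (degree G s ≟ 1) λ (sup , lf) → support⇒¬leaf s sup lf

    support-charged : ∀ s → support s ≤ member D s * support s + ∑[ u < n ] (leafMember u * 𝟙 (adj G u s))
    support-charged s with isSupport? G s
    ... | no _    = z≤n
    ... | yes sup with lookup D s in s∈?D | satisfied sup
    ...   | true  | _ = s≤s z≤n
    ...   | false | u , su , u-leaf with dominating u
    ...     | inj₁ u∈D = ≤-trans (≤-reflexive (sym term≡1)) (term≤sum (λ u → leafMember u * 𝟙 (adj G u s)) u)
      where
      term≡1 : leafMember u * 𝟙 (adj G u s) ≡ 1
      term≡1 = cong₂ _*_ (cong₂ _*_ (cong 𝟙 ([]=⇒lookup u∈D)) (cong 𝟙 (dec-true (degree G u ≟ 1) u-leaf)))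
                         (T⇒𝟙≡1 (adj-sym G su))
    ...     | inj₂ (w , w∈D , wu) with refl ← leaf-neighbour-unique G u-leaf (adj-sym G wu) (adj-sym G su)
                                   with () ← trans (sym s∈?D) ([]=⇒lookup w∈D)

proposition4 : (n : ℕ) → n ≥ 2 → (T : Graph n) → IsTree T →
    (γ : ℕ) → IsDominationNumber T γ →
    4 * γ ≥ length (deg≥2 T) + length (supp T)
proposition4 n _ G (connected , edges) γ ((D , dominating , ∣D∣≡γ) , _)
  with any? (λ s → isSupport? G s ×-dec (degree G s ≟ 1))
... | yes (s , s-support , s-leaf) = begin
  length (deg≥2 G) + length (supp G)  ≡⟨ cong (_+ length (supp G)) (length-deg≥2≡0 G degree≤1) ⟩
  length (supp G)                     ≤⟨ length-supp≤n G ⟩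
  n                                   ≤⟨ n≤2∣D∣ G D dominating degree≤1 ⟩
  2 * ∣ D ∣                           ≤⟨ *-monoˡ-≤ ∣ D ∣ {2} {4} (s≤s (s≤s z≤n)) ⟩
  4 * ∣ D ∣                           ≡⟨ cong (4 *_) ∣D∣≡γ ⟩
  4 * γ                               ∎
  where
  open ≤-Reasoning
  degree≤1 : ∀ v → degree G v ≤ 1
  degree≤1 v with u , su , u-leaf ← satisfied s-support =
    ≤-reflexive (leaf-edge⇒all-leaves G connected s-leaf u-leaf su v)
... | no no-leaf-support = begin
  length (deg≥2 G) + length (supp G)
    ≤⟨ +-mono-≤ (∣deg≥2∣≤3∣D∣ G D dominating (≤-trans (≤-reflexive edges) (m∸n≤m n 1)))
                (∣supp∣≤∣D∣ G D dominating λ v v-support v-leaf → no-leaf-support (v , v-support , v-leaf)) ⟩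
  3 * ∣ D ∣ + ∣ D ∣                   ≡⟨ +-comm (3 * ∣ D ∣) ∣ D ∣ ⟩
  4 * ∣ D ∣                           ≡⟨ cong (4 *_) ∣D∣≡γ ⟩
  4 * γ                               ∎
  where open ≤-Reasoning
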